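{- If $G$ is a finite connected $r$-regular graph of diameter $2$ and girth $5$, then $c_H(G)=r$.
   Context: Hyperopic Cops and Robbers on a finite connected simple graph $G$: one player controls $k$ cops, the other a single robber. The cops first choose starting vertices (several cops may share a vertex), then the robber chooses a starting vertex; afterwards, in each round, each cop moves to an adjacent vertex or stays put, and then the robber moves to an adjacent vertex or stays put. The robber always knows the cops' positions. The robber is invisible to the cops exactly when the robber's vertex is adjacent to the vertex of every cop (a robber on the same vertex as a cop is visible); otherwise the cops see the robber's position. The cops win if after finitely many rounds some cop occupies the robber's vertex, and the cops' strategy must guarantee this with certainty (no chance allowed). The hyperopic cop number $c_H(G)$ is the minimum $k$ for which $k$ cops have a winning strategy. -}

module Defs where

open import Data.Nat using (ℕ; zero; suc; _+_; _≤_)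
open import Data.Fin using (Fin; zero; suc; inject₁; fromℕ)
open import Data.Bool using (Bool; true; false; if_then_else_)
open import Data.List using (List; []; _∷_; map; allFin)
open import Data.Nat.ListAction using (sum)
open import Data.Bool.ListAction using (all)
open import Data.Maybe using (Maybe; just; nothing)
open import Data.Product using (Σ; ∃; _×_; _,_; proj₁; proj₂)
open import Data.Sum using (_⊎_)
open import Function.Definitions using (Injective)
open import Relation.Binary.PropositionalEquality using (_≡_)

record SimpleGraph (n : ℕ) : Set where
  field
    adj   : Fin n → Fin n → Bool
    sym   : ∀ u v → adj u v ≡ adj v u
    irrefl : ∀ v → adj v v ≡ false

module _ {n : ℕ} (G : SimpleGraph n) where
  open SimpleGraph G

  Adj : Fin n → Fin n → Set
  Adj u v = adj u v ≡ true

  degree : Fin n → ℕ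
  degree v = sum (map (λ w → if adj v w then 1 else 0) (allFin n))

  Regular : ℕ → Set
  Regular r = ∀ v → degree v ≡ r

  Walk : Fin n → Fin n → ℕ → Set
  Walk u w zero    = u ≡ w
  Walk u w (suc l) = Σ (Fin n) λ v → Adj u v × Walk v w l

  Connected : Set
  Connected = ∀ u v → ∃ λ l → Walk u v l

  Diameter : ℕ → Set
  Diameter d = (∀ u v → ∃ λ l → l ≤ d × Walk u v l)
             × (Σ (Fin n) λ u → Σ (Fin n) λ v → ∀ l → Walk u v l → d ≤ l)

  record Cycle (j : ℕ) : Set where
    field
      vtx      : Fin (3 + j) → Fin n
      distinct : Injective _≡_ _≡_ vtx
      step     : ∀ (i : Fin (2 + j)) → Adj (vtx (inject₁ i)) (vtx (suc i))
      close    : Adj (vtx (fromℕ (2 + j))) (vtx zero)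

  Girth : ℕ → Set
  Girth g = (Σ ℕ λ j → 3 + j ≡ g × Cycle j) × (∀ j → Cycle j → g ≤ 3 + j)

  Config : ℕ → Set
  Config k = Fin k → Fin n

  -- what the cops observe: nothing (invisible) iff the robber is adjacent
  -- to every cop, otherwise the robber's vertex
  Obs : Set
  Obs = Maybe (Fin n)

  observe : ∀ {k} → Config k → Fin n → Obs
  observe {k} c v = if all (λ i → adj (c i) v) (allFin k) then nothing else just v

  LegalMove : ∀ {k} → Config k → Config k → Set
  LegalMove {k} c c' = ∀ (i : Fin k) → c' i ≡ c i ⊎ Adj (c i) (c' i)

  -- deterministic cop strategy: initial placement, then each move depends
  -- on the current configuration and the history of observations
  -- (most recent first)
  record CopStrategy (k : ℕ) : Set where
    field
      start : Config k
      move  : (c : Config k) → List Obs → Σ (Config k) λ c' → LegalMove c c'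

  RobberWalk : (ℕ → Fin n) → Set
  RobberWalk ρ = ∀ t → ρ (suc t) ≡ ρ t ⊎ Adj (ρ t) (ρ (suc t))

  -- state at time t (after t rounds): cop configuration and observation history
  play : ∀ {k} → CopStrategy k → (ℕ → Fin n) → ℕ → Config k × List Obs
  play σ ρ zero = CopStrategy.start σ , observe (CopStrategy.start σ) (ρ zero) ∷ []
  play σ ρ (suc t) with play σ ρ t
  ... | c , h = let c' = proj₁ (CopStrategy.move σ c h)
                in c' , (observe c' (ρ (suc t)) ∷ observe c' (ρ t) ∷ h)

  cops : ∀ {k} → CopStrategy k → (ℕ → Fin n) → ℕ → Config k
  cops σ ρ t = proj₁ (play σ ρ t)

  -- capture at time t: a cop on the robber's vertex at the start of round t,
  -- or a cop moving onto the robber's vertex during round t+1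
  Captured : ∀ {k} → CopStrategy k → (ℕ → Fin n) → ℕ → Set
  Captured {k} σ ρ t = Σ (Fin k) λ i → cops σ ρ t i ≡ ρ t ⊎ cops σ ρ (suc t) i ≡ ρ t

  Winning : ∀ {k} → CopStrategy k → Set
  Winning σ = ∀ ρ → RobberWalk ρ → ∃ λ t → Captured σ ρ t

  CopsWin : ℕ → Set
  CopsWin k = Σ (CopStrategy k) Winning

  HyperopicCopNumber : ℕ → Set
  HyperopicCopNumber m = CopsWin m × (∀ k → CopsWin k → m ≤ k)

module Submission where

-- Girth 5 means that a cop not on a vertex u covers (occupies or is adjacent to) at most one
-- neighbour of u. Hence against fewer than r cops the robber, even if always seen, can forever
-- step to a neighbour that no cop can reach with its next move. Conversely, put r cops on the
-- neighbourhood N(v) of a vertex v. They see the robber unless he is adjacent to all of them,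
-- and as there is no 4-cycle, two neighbours of v have no common neighbour other than v; so the
-- cops always know where he is. By diameter 2 every vertex is on or next to a vertex of N(v),
-- and an adjacent cop steps onto the robber with the first move.

open import Data.Bool using (true; false; if_then_else_)
import Data.Bool as Bool
open import Data.Bool.ListAction using (all)
open import Data.Bool.Properties using (T-≡)
open import Data.Empty using (⊥; ⊥-elim)
open import Data.Fin using (Fin; zero; suc; fromℕ; _≟_)
open import Data.Fin.Properties using (pigeonhole; any?; all?; <⇒≢)
open import Data.List using (List; []; _∷_; map; allFin; length; lookup; filter)
open import Data.List.Membership.Propositional using (_∈_)
open import Data.List.Membership.Propositional.Properties using (∈-lookup; ∈-allFin; ∈-filter⁺; ∈-filter⁻)
import Data.List.Relation.Unary.All as All
import Data.List.Relation.Unary.All.Properties as All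
open import Data.List.Relation.Unary.All using ([]; _∷_)
open import Data.List.Relation.Unary.AllPairs using ([]; _∷_)
import Data.List.Relation.Unary.Any as Any
open import Data.List.Relation.Unary.Any.Properties using (lookup-index)
open import Data.List.Relation.Unary.Unique.Propositional using (Unique)
import Data.List.Relation.Unary.Unique.Propositional.Properties as Unique
open import Data.Maybe using (fromMaybe)
open import Data.Nat using (ℕ; zero; suc; _+_; _≤_; _<_; s≤s)
open import Data.Nat.ListAction using (sum)
open import Data.Nat.Properties using (≮⇒≥)
open import Data.Product using (∃; _×_; _,_; proj₁; proj₂; uncurry)
open import Data.Sum using (_⊎_; inj₁; inj₂)
open import Function using (_∘_)
open import Function.Bundles using (Equivalence)
open import Function.Definitions using (Injective)
open import Relation.Binary.Definitions using (Decidable)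
open import Relation.Binary.PropositionalEquality
open import Relation.Nullary using (¬_; yes; no; contradiction)
open import Relation.Nullary.Decidable using (¬?; _⊎-dec_)

open import Defs

lookup-injective : ∀ {A : Set} {xs : List A} → Unique xs → Injective _≡_ _≡_ (lookup xs)
lookup-injective (_ ∷ _)         {zero}  {zero}  _  = refl
lookup-injective (x≢xs ∷ _)      {zero}  {suc j} eq = contradiction eq (All.lookup x≢xs (∈-lookup j))
lookup-injective (x≢xs ∷ _)      {suc i} {zero}  eq = contradiction (sym eq) (All.lookup x≢xs (∈-lookup i))
lookup-injective (_ ∷ unique-xs) {suc i} {suc j} eq = cong suc (lookup-injective unique-xs eq)

record Enumeration {A : Set} (P : A → Set) (r : ℕ) : Set where
  field
    elem      : Fin r → A
    injective : Injective _≡_ _≡_ elem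
    sound     : ∀ j → P (elem j)
    complete  : ∀ {x} → P x → ∃ λ j → elem j ≡ x

enumerate : ∀ {A : Set} {P : A → Set} (xs : List A) → Unique xs →
            (∀ {x} → x ∈ xs → P x) → (∀ {x} → P x → x ∈ xs) → Enumeration P (length xs)
enumerate xs unique sound complete = record
  { elem      = lookup xs
  ; injective = lookup-injective unique
  ; sound     = λ j → sound (∈-lookup j)
  ; complete  = λ px → let x∈xs = complete px in Any.index x∈xs , sym (lookup-index x∈xs)
  }

partialFunction-¬onto : ∀ {k r} → k < r → (R : Fin k → Fin r → Set) →
                        (∀ {i j j′} → R i j → R i j′ → j ≡ j′) → ¬ (∀ j → ∃ λ i → R i j)
partialFunction-¬onto k<r R functional onto with pigeonhole k<r (proj₁ ∘ onto)
... | j , j′ , j<j′ , same =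
  <⇒≢ j<j′ (functional (proj₂ (onto j)) (subst (λ i → R i j′) (sym same) (proj₂ (onto j′))))

partialFunction-misses : ∀ {k r} → k < r → (R : Fin k → Fin r → Set) → Decidable R →
                         (∀ {i j j′} → R i j → R i j′ → j ≡ j′) → ∃ λ j → ∀ i → ¬ R i j
partialFunction-misses k<r R R? functional with any? (λ j → all? (λ i → ¬? (R? i j)))
... | yes missed  = missed
... | no  ¬missed = contradiction onto (partialFunction-¬onto k<r R functional)
  where
  onto : ∀ j → ∃ λ i → R i j
  onto j with any? (λ i → R? i j)
  ... | yes hit  = hit
  ... | no  ¬hit = contradiction (j , λ i Rij → ¬hit (i , Rij)) ¬missed

module _ {n : ℕ} (G : SimpleGraph n) where
  open SimpleGraph G using (adj)

  -- Stated as y ≡ x ⊎ … so that a legal move c ↦ c′ is literally ∀ i → Covers (c i) (c′ i).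
  Covers : Fin n → Fin n → Set
  Covers x y = y ≡ x ⊎ Adj G x y

  covers? : Decidable Covers
  covers? x y = (y ≟ x) ⊎-dec (adj x y Bool.≟ true)

  adj-sym : ∀ {u v} → Adj G u v → Adj G v u
  adj-sym {u} {v} uv = trans (SimpleGraph.sym G v u) uv

  adj⇒≢ : ∀ {u v} → Adj G u v → u ≢ v
  adj⇒≢ {u} uu refl with trans (sym uu) (SimpleGraph.irrefl G u)
  ... | ()

  moveTo : Fin n → Fin n → Fin n
  moveTo goal y = if adj y goal then goal else y

  moveTo-legal : ∀ goal y → Covers y (moveTo goal y)
  moveTo-legal goal y with adj y goal in y~goal
  ... | true  = inj₂ y~goal
  ... | false = inj₁ refl

  moveTo-arrives : ∀ {goal y} → Adj G y goal → moveTo goal y ≡ goal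
  moveTo-arrives y~goal rewrite y~goal = refl

  observe-located : ∀ {k} (c : Config G k) (d w : Fin n) →
                    ((∀ i → Adj G (c i) w) → d ≡ w) → fromMaybe d (observe G c w) ≡ w
  observe-located {k} c d w invisible⇒d≡w with all (λ i → adj (c i) w) (allFin k) in all-adjacent
  ... | true  = invisible⇒d≡w λ i →
    Equivalence.to T-≡ (All.lookup (All.all⁺ _ (allFin k) (Equivalence.from T-≡ all-adjacent)) (∈-allFin i))
  ... | false = refl

  neighbours : Fin n → List (Fin n)
  neighbours u = filter (λ w → adj u w Bool.≟ true) (allFin n)

  length-neighbours : ∀ u → length (neighbours u) ≡ degree G u
  length-neighbours u = count (allFin n)
    where
    count : ∀ ws → length (filter (λ w → adj u w Bool.≟ true) ws) ≡ sum (map (λ w → if adj u w then 1 else 0) ws)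
    count []       = refl
    count (w ∷ ws) with adj u w
    ... | true  = cong suc (count ws)
    ... | false = count ws

  neighbourEnumeration : ∀ u → Enumeration (Adj G u) (degree G u)
  neighbourEnumeration u = subst (Enumeration (Adj G u)) (length-neighbours u)
    (enumerate (neighbours u) (Unique.filter⁺ _ (Unique.allFin⁺ n))
               (λ w∈ → proj₂ (∈-filter⁻ _ {xs = allFin n} w∈))
               (∈-filter⁺ _ (∈-allFin _)))

  module NoShortCycles (girth≥5 : ∀ j → Cycle G j → 5 ≤ 3 + j) where

    no-triangle : ∀ {a b c} → Adj G a b → Adj G b c → Adj G c a → ⊥
    no-triangle {a} {b} {c} ab bc ca with girth≥5 0 triangle
      where
      triangle : Cycle G 0
      triangle = record
        { vtx      = lookup (a ∷ b ∷ c ∷ [])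
        ; distinct = lookup-injective ((adj⇒≢ ab ∷ adj⇒≢ (adj-sym ca) ∷ []) ∷ (adj⇒≢ bc ∷ []) ∷ [] ∷ [])
        ; step     = λ { zero → ab ; (suc zero) → bc }
        ; close    = ca
        }
    ... | s≤s (s≤s (s≤s ()))

    no-square : ∀ {a b c d} → Adj G a b → Adj G b c → Adj G c d → Adj G d a → a ≢ c → b ≢ d → ⊥
    no-square {a} {b} {c} {d} ab bc cd da a≢c b≢d with girth≥5 1 square
      where
      square : Cycle G 1
      square = record
        { vtx      = lookup (a ∷ b ∷ c ∷ d ∷ [])
        ; distinct = lookup-injective ((adj⇒≢ ab ∷ a≢c ∷ adj⇒≢ (adj-sym da) ∷ []) ∷
                                       (adj⇒≢ bc ∷ b≢d ∷ []) ∷ (adj⇒≢ cd ∷ []) ∷ [] ∷ [])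
        ; step     = λ { zero → ab ; (suc zero) → bc ; (suc (suc zero)) → cd }
        ; close    = da
        }
    ... | s≤s (s≤s (s≤s (s≤s ())))

    covers-unique : ∀ {x u y y′} → x ≢ u → Adj G u y → Adj G u y′ → Covers x y → Covers x y′ → y ≡ y′
    covers-unique {y = y} {y′} x≢u uy uy′ xy xy′ with y ≟ y′
    ... | yes y≡y′ = y≡y′
    ... | no  y≢y′ with xy | xy′
    ... | inj₁ refl | inj₁ refl = refl
    ... | inj₁ refl | inj₂ yy′  = contradiction (adj-sym uy′) (no-triangle uy yy′)
    ... | inj₂ xy   | inj₁ refl = contradiction (adj-sym uy) (no-triangle uy′ xy)
    ... | inj₂ xy   | inj₂ xy′  = ⊥-elim (no-square uy (adj-sym xy) xy′ (adj-sym uy′) (x≢u ∘ sym) y≢y′)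

    module _ {k : ℕ} (k<degree : ∀ u → k < degree G u) where

      Unguarded : Config G k → Fin n → Set
      Unguarded c y = ∀ i → ¬ Covers (c i) y

      unguarded-neighbour : (c : Config G k) (u : Fin n) → (∀ i → c i ≢ u) →
                            ∃ λ y → Adj G u y × Unguarded c y
      unguarded-neighbour c u free-u = elem j , sound j , unguarded
        where
        open Enumeration (neighbourEnumeration u)
        missed = partialFunction-misses (k<degree u)
                   (λ i j → Covers (c i) (elem j)) (λ i j → covers? (c i) (elem j))
                   (λ {i} cov cov′ → injective (covers-unique (free-u i) (sound _) (sound _) cov cov′))
        j = proj₁ missed
        unguarded = proj₂ missed

      unguarded-vertex : Fin n → (c : Config G k) → ∃ (Unguarded c)
      unguarded-vertex v c = proj₁ step-aside , proj₂ (proj₂ step-aside)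
        where
        open Enumeration (neighbourEnumeration v)
        unoccupied = partialFunction-misses (k<degree v) (λ i j → c i ≡ elem j) (λ i j → c i ≟ elem j)
                       (λ ci≡j ci≡j′ → injective (trans (sym ci≡j) ci≡j′))
        step-aside = unguarded-neighbour c (elem (proj₁ unoccupied)) (proj₂ unoccupied)

      module Evasion (v₀ : Fin n) (σ : CopStrategy G k) where
        open CopStrategy σ

        record State : Set where
          constructor state
          field
            config  : Config G k
            history : List (Obs G)
            robber  : Fin n
            safe    : Unguarded config robber
        open State

        moved : State → Config G k
        moved s = proj₁ (move (config s) (history s))

        moved-off-robber : ∀ s i → moved s i ≢ robber s
        moved-off-robber s i moved≡robber =
          safe s i (subst (Covers (config s i)) moved≡robber (proj₂ (move (config s) (history s)) i))

        escape : ∀ s → ∃ λ y → Adj G (robber s) y × Unguarded (moved s) y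
        escape s = unguarded-neighbour (moved s) (robber s) (moved-off-robber s)

        next : State → State
        next s = state c′ (observe G c′ y ∷ observe G c′ (robber s) ∷ history s) y (proj₂ (proj₂ (escape s)))
          where
          c′ = moved s
          y  = proj₁ (escape s)

        states : ℕ → State
        states zero    = state start (observe G start u₀ ∷ []) u₀ (proj₂ (unguarded-vertex v₀ start))
          where u₀ = proj₁ (unguarded-vertex v₀ start)
        states (suc t) = next (states t)

        ρ : ℕ → Fin n
        ρ t = robber (states t)

        ρ-walk : RobberWalk G ρ
        ρ-walk t = inj₂ (proj₁ (proj₂ (escape (states t))))

        play-states : ∀ t → play G σ ρ t ≡ (config (states t) , history (states t))
        play-states zero    = refl
        play-states (suc t) rewrite play-states t = refl

        never-captured : ∀ t → ¬ Captured G σ ρ t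
        never-captured t (i , inj₁ caught) rewrite play-states t = safe (states t) i (inj₁ (sym caught))
        never-captured t (i , inj₂ caught) rewrite play-states t = moved-off-robber (states t) i caught

      ¬copsWin : Fin n → ¬ CopsWin G k
      ¬copsWin v₀ (σ , winning) = uncurry never-captured (winning ρ ρ-walk)
        where open Evasion v₀ σ

    module _ {v a b : Fin n} (va : Adj G v a) (vb : Adj G v b) (a≢b : a ≢ b)
             (eccentricity≤2 : ∀ w → ∃ λ l → l ≤ 2 × Walk G v w l) where
      open Enumeration (neighbourEnumeration v) renaming (elem to cop)

      invisible⇒centre : ∀ {w} → (∀ j → Adj G (cop j) w) → v ≡ w
      invisible⇒centre {w} adjacent-to-all with w ≟ v
      ... | yes w≡v = sym w≡v
      ... | no  w≢v =
        ⊥-elim (no-square va (adjacent a va) (adj-sym (adjacent b vb)) (adj-sym vb) (w≢v ∘ sym) a≢b)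
        where
        adjacent : ∀ x → Adj G v x → Adj G x w
        adjacent x vx with complete vx
        ... | j , refl = adjacent-to-all j

      covered-by-cop : ∀ w → ∃ λ j → Covers (cop j) w
      covered-by-cop w with eccentricity≤2 w
      ... | 0 , _ , refl with complete va
      ...   | j , refl = j , inj₂ (adj-sym va)
      covered-by-cop w | 1 , _ , x , vx , refl with complete vx
      ...   | j , refl = j , inj₁ refl
      covered-by-cop w | 2 , _ , x , vx , y , xy , refl with complete vx
      ...   | j , refl = j , inj₂ xy
      covered-by-cop w | suc (suc (suc _)) , s≤s (s≤s ()) , _

      target : List (Obs G) → Fin n
      target []      = v
      target (o ∷ _) = fromMaybe v o

      neighbourhoodStrategy : CopStrategy G (degree G v)
      neighbourhoodStrategy = record
        { start = cop
        ; move  = λ c h → (λ i → moveTo (target h) (c i)) , (λ i → moveTo-legal (target h) (c i))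
        }

      neighbourhood-winning : Winning G neighbourhoodStrategy
      neighbourhood-winning ρ _ with covered-by-cop (ρ 0)
      ... | j , inj₁ robber-on-cop = 0 , j , inj₁ (sym robber-on-cop)
      ... | j , inj₂ cop~robber    = 0 , j , inj₂ (begin
            moveTo (fromMaybe v (observe G cop (ρ 0))) (cop j) ≡⟨ cong (λ goal → moveTo goal (cop j)) located ⟩
            moveTo (ρ 0) (cop j)                                ≡⟨ moveTo-arrives cop~robber ⟩
            ρ 0                                                 ∎)
        where
        open ≡-Reasoning
        located = observe-located cop v (ρ 0) invisible⇒centre

      neighbourhood-copsWin : CopsWin G (degree G v)
      neighbourhood-copsWin = neighbourhoodStrategy , neighbourhood-winning

mainTheorem13 : (n : ℕ) (G : SimpleGraph n) (r : ℕ) →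
    Connected G → Regular G r → Diameter G 2 → Girth G 5 →
    HyperopicCopNumber G r
mainTheorem13 n G r _ regular (eccentricity≤2 , _) ((.2 , refl , pentagon) , girth≥5) =
  subst (CopsWin G) (regular v) (neighbourhood-copsWin va vb a≢b (eccentricity≤2 v)) ,
  λ k copsWin → ≮⇒≥ λ k<r → ¬copsWin (λ u → subst (k <_) (sym (regular u)) k<r) v copsWin
  where
  open NoShortCycles G girth≥5
  open Cycle pentagon
  v = vtx zero
  va : Adj G v (vtx (suc zero))
  va = step zero
  vb : Adj G v (vtx (fromℕ 4))
  vb = adj-sym G close
  a≢b : vtx (suc zero) ≢ vtx (fromℕ 4)
  a≢b a≡b with distinct a≡b
  ... | ()
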